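{- For every positive integer $b$ there exist a connected functional digraph $D$ with $\gamma_1^o(D)-\gamma(D)=b$ and a directed tree $T$ with $\gamma_1^o(T)-\gamma(T)=b$.
   Context: All digraphs are finite, without loops or multiple arcs (pairs of opposite arcs allowed). A digraph is functional if every vertex has out-degree $1$; it is connected if its underlying graph is connected. A directed tree is a digraph whose underlying graph is a tree. A set $S\subseteq V(D)$ is a dominating set if every vertex of $\overline{S}=V(D)\setminus S$ has an in-neighbor in $S$; $\gamma(D)$ is the minimum size of a dominating set. With $deg^-_S(v)$ the number of in-neighbors of $v$ in $S$, a set $S$ is a global offensive $1$-alliance if it is dominating and $deg^-_S(v)\ge deg^-_{\overline{S}}(v)+1$ for every $v\in\overline{S}$; $\gamma_1^o(D)$ is the minimum size of such a set. -}

module Defs where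

open import Data.Nat using (ℕ; zero; suc; _+_; _∸_; _≤_)
open import Data.Bool using (Bool; true; false)
open import Data.Fin using (Fin)
open import Data.Fin.Subset using (Subset; _∈_; _∉_; _∩_; ∁; ∣_∣)
open import Data.Vec using (tabulate)
open import Data.List using (map; allFin)
open import Data.Nat.ListAction using (sum)
open import Data.Product using (Σ; ∃; _×_; _,_)
open import Data.Sum using (_⊎_)
open import Relation.Binary.PropositionalEquality using (_≡_)

-- A digraph on vertex set Fin n: adjacency (arc u → v iff adj u v ≡ true),
-- no loops. Opposite arcs are allowed; multiple arcs impossible by construction.
record Digraph (n : ℕ) : Set where
  field
    adj      : Fin n → Fin n → Bool
    loopless : ∀ v → adj v v ≡ false
open Digraph public

module _ {n : ℕ} (D : Digraph n) where

  N⁺ : Fin n → Subset n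
  N⁺ v = tabulate (λ w → adj D v w)

  N⁻ : Fin n → Subset n
  N⁻ v = tabulate (λ u → adj D u v)

  outdeg : Fin n → ℕ
  outdeg v = ∣ N⁺ v ∣

  deg⁻ : Subset n → Fin n → ℕ
  deg⁻ S v = ∣ S ∩ N⁻ v ∣

  arcCount : ℕ
  arcCount = sum (map outdeg (allFin n))

  Functional : Set
  Functional = ∀ v → outdeg v ≡ 1

  data UWalk : Fin n → Fin n → Set where
    here  : ∀ {u} → UWalk u u
    there : ∀ {u w v} → (adj D u w ≡ true ⊎ adj D w u ≡ true) → UWalk w v → UWalk u v

  Connected : Set
  Connected = ∀ u v → UWalk u v

  -- underlying graph is a tree: nonempty, connected, with n - 1 edges
  -- (counting arcs; a pair of opposite arcs gives a double edge, i.e. a cycle)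
  DirectedTree : Set
  DirectedTree = (1 ≤ n) × Connected × (arcCount ≡ n ∸ 1)

  Dominating : Subset n → Set
  Dominating S = ∀ v → v ∉ S → ∃ λ u → u ∈ S × adj D u v ≡ true

  GlobalOffensive1Alliance : Subset n → Set
  GlobalOffensive1Alliance S =
    Dominating S × (∀ v → v ∉ S → deg⁻ (∁ S) v + 1 ≤ deg⁻ S v)

IsMinimum : {n : ℕ} → (Subset n → Set) → ℕ → Set
IsMinimum {n} P k = (∃ λ S → P S × ∣ S ∣ ≡ k) × (∀ S → P S → k ≤ ∣ S ∣)

IsDominationNumber : {n : ℕ} → Digraph n → ℕ → Set
IsDominationNumber D k = IsMinimum (Dominating D) k

IsOffAllianceNumber : {n : ℕ} → Digraph n → ℕ → Set
IsOffAllianceNumber D k = IsMinimum (GlobalOffensive1Alliance D) k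

{-# OPTIONS --safe #-}
-- The witnesses are one digraph on a hub c, a leaf x and b gadgets, each a path far → mid → apex
-- together with an arc near → apex; every apex points to c, and c → x.  Adding the arc x → c makes it
-- functional, omitting it makes it a directed tree.  A dominating set must contain the two sources
-- near, far of every gadget and one of c, x, and c together with the sources suffices: γ = 1 + 2b.
-- An apex outside an offensive alliance has only two in-neighbours, so both lie in the alliance;
-- hence every gadget contributes mid or apex as a third vertex, and c with near, far, mid of every
-- gadget is an alliance: γ₁ᵒ = 1 + 3b.
module Submission where

open import Defs
open import Data.Nat using (ℕ; zero; suc; _+_; _*_; _≤_; _<_; z≤n; s≤s)
open import Data.Nat.Properties
  using (≤-trans; ≤-reflexive; +-mono-≤; +-monoˡ-≤; <-irrefl; +-comm; *-suc; *-identityʳ)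
open import Data.Nat.ListAction using (sum)
open import Data.Bool using (Bool; true; false; _∧_)
open import Data.Bool.Properties using (∧-zeroʳ)
open import Data.Fin using (Fin; zero; suc; _≟_; combine; remQuot)
open import Data.Fin.Properties using (remQuot-combine; combine-remQuot)
open import Data.Fin.Subset using (Subset; inside; outside; _∈_; _∉_; _⊆_; _∩_; ∁; ∣_∣; ⁅_⁆; Empty)
open import Data.Fin.Subset.Properties
  using (_∈?_; ∣p∣≤∣x∷p∣; ∣⁅x⁆∣≡1; x∈⁅x⁆; x∈⁅y⁆⇒x≡y; ⊆-antisym; p⊆q⇒∣p∣≤∣q∣;
         x∈p∩q⁺; x∈p∩q⁻; x∉p⇒x∈∁p; x∈∁p⇒x∉p; Empty-unique; ∣⊥∣≡0)
open import Data.Vec using (Vec; []; _∷_; _++_; concat; replicate; lookup; tabulate; group; here; there)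
open import Data.Vec.Properties
  using (lookup∘tabulate; tabulate∘lookup; tabulate-cong; []=⇒lookup; lookup⇒[]=; lookup-concat; lookup-replicate)
import Data.List as List
open import Data.List.Properties using (map-tabulate)
open import Data.Product using (Σ; ∃; _×_; _,_; proj₁; proj₂; uncurry)
open import Data.Sum using (_⊎_; inj₁; inj₂; [_,_]′; swap)
import Data.Sum as Sum
open import Function using (_∘_; id)
open import Relation.Nullary using (Dec; yes; no; does; contradiction)
open import Relation.Nullary.Decidable using (dec-true)
open import Relation.Binary.PropositionalEquality
  using (_≡_; _≢_; refl; sym; trans; cong; cong₂; subst; module ≡-Reasoning)

∈tabulate⁺ : ∀ {n} {f : Fin n → Bool} {x} → f x ≡ true → x ∈ tabulate f
∈tabulate⁺ {f = f} {x} fx = lookup⇒[]= x (tabulate f) (trans (lookup∘tabulate f x) fx)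

∈tabulate⁻ : ∀ {n} {f : Fin n → Bool} {x} → x ∈ tabulate f → f x ≡ true
∈tabulate⁻ {f = f} {x} x∈ = trans (sym (lookup∘tabulate f x)) ([]=⇒lookup x∈)

x∈p⇒0<∣p∣ : ∀ {n} {p : Subset n} {x} → x ∈ p → 0 < ∣ p ∣
x∈p⇒0<∣p∣ here = s≤s z≤n
x∈p⇒0<∣p∣ {p = y ∷ p} (there x∈p) = ≤-trans (x∈p⇒0<∣p∣ x∈p) (∣p∣≤∣x∷p∣ y p)

Empty⇒∣p∣≡0 : ∀ {n} {p : Subset n} → Empty p → ∣ p ∣ ≡ 0
Empty⇒∣p∣≡0 {n} empty = trans (cong ∣_∣ (Empty-unique empty)) (∣⊥∣≡0 n)

∣p++q∣≡∣p∣+∣q∣ : ∀ {m n} (p : Subset m) (q : Subset n) → ∣ p ++ q ∣ ≡ ∣ p ∣ + ∣ q ∣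
∣p++q∣≡∣p∣+∣q∣ []            q = refl
∣p++q∣≡∣p∣+∣q∣ (inside ∷ p)  q = cong suc (∣p++q∣≡∣p∣+∣q∣ p q)
∣p++q∣≡∣p∣+∣q∣ (outside ∷ p) q = ∣p++q∣≡∣p∣+∣q∣ p q

∣concat-replicate∣ : ∀ {k} n (p : Subset k) → ∣ concat (replicate n p) ∣ ≡ n * ∣ p ∣
∣concat-replicate∣ zero    p = refl
∣concat-replicate∣ (suc n) p =
  trans (∣p++q∣≡∣p∣+∣q∣ p _) (cong (∣ p ∣ +_) (∣concat-replicate∣ n p))

*≤∣concat∣ : ∀ {n k m} (ps : Vec (Subset k) n) → (∀ i → m ≤ ∣ lookup ps i ∣) → n * m ≤ ∣ concat ps ∣
*≤∣concat∣ []       _ = z≤n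
*≤∣concat∣ (p ∷ ps) h =
  subst (_ ≤_) (sym (∣p++q∣≡∣p∣+∣q∣ p (concat ps))) (+-mono-≤ (h zero) (*≤∣concat∣ ps (h ∘ suc)))

block : ∀ {n k} → Fin n → Subset (n * k) → Subset k
block i p = tabulate (lookup p ∘ combine i)

*≤∣p∣-by-blocks : ∀ n {k m} (p : Subset (n * k)) → (∀ i → m ≤ ∣ block i p ∣) → n * m ≤ ∣ p ∣
*≤∣p∣-by-blocks n {k} {m} p h with group n k p
... | ps , refl = *≤∣concat∣ ps (λ i → subst (λ q → m ≤ ∣ q ∣) (block-concat i) (h i))
  where
  block-concat : ∀ i → block i (concat ps) ≡ lookup ps i
  block-concat i = trans (tabulate-cong (lookup-concat ps i)) (tabulate∘lookup (lookup ps i))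

1+∣p∣≤∣x∷y∷p∣ : ∀ {n x y} (p : Subset n) → zero ∈ x ∷ y ∷ p ⊎ suc zero ∈ x ∷ y ∷ p →
                suc ∣ p ∣ ≤ ∣ x ∷ y ∷ p ∣
1+∣p∣≤∣x∷y∷p∣ {y = y} p (inj₁ here)         = s≤s (∣p∣≤∣x∷p∣ y p)
1+∣p∣≤∣x∷y∷p∣ {x = x} p (inj₂ (there here)) = ∣p∣≤∣x∷p∣ x (inside ∷ p)

sum-tabulate-const : ∀ {n c} {g : Fin n → ℕ} → (∀ i → g i ≡ c) → sum (List.tabulate g) ≡ n * c
sum-tabulate-const {zero}  _ = refl
sum-tabulate-const {suc n} h = cong₂ _+_ (h zero) (sum-tabulate-const (h ∘ suc))

module _ {n : ℕ} (D : Digraph n) where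

  outdeg≡1 : ∀ {v w} → adj D v w ≡ true → (∀ x → adj D v x ≡ true → x ≡ w) → outdeg D v ≡ 1
  outdeg≡1 {v} {w} v→w unique = trans (cong ∣_∣ (⊆-antisym N⁺⊆⁅w⁆ ⁅w⁆⊆N⁺)) (∣⁅x⁆∣≡1 w)
    where
    N⁺⊆⁅w⁆ : N⁺ D v ⊆ ⁅ w ⁆
    N⁺⊆⁅w⁆ {x} x∈ = subst (_∈ ⁅ w ⁆) (sym (unique x (∈tabulate⁻ x∈))) (x∈⁅x⁆ w)
    ⁅w⁆⊆N⁺ : ⁅ w ⁆ ⊆ N⁺ D v
    ⁅w⁆⊆N⁺ {x} x∈ = subst (_∈ N⁺ D v) (sym (x∈⁅y⁆⇒x≡y w x∈)) (∈tabulate⁺ v→w)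

  outdeg≡0 : ∀ {v} → (∀ x → adj D v x ≢ true) → outdeg D v ≡ 0
  outdeg≡0 sink = Empty⇒∣p∣≡0 λ (x , x∈) → sink x (∈tabulate⁻ x∈)

  source∈dominating : ∀ {S v} → Dominating D S → (∀ u → adj D u v ≢ true) → v ∈ S
  source∈dominating {S} {v} dominating source with v ∈? S
  ... | yes v∈S = v∈S
  ... | no  v∉S = let u , _ , u→v = dominating v v∉S in contradiction u→v (source u)

  sole-in-neighbour∈dominating : ∀ {S u v} → Dominating D S → v ∉ S →
                                 (∀ x → adj D x v ≡ true → x ≡ u) → u ∈ S
  sole-in-neighbour∈dominating {S} {v = v} dominating v∉S sole =
    let x , x∈S , x→v = dominating v v∉S in subst (_∈ S) (sole x x→v) x∈S

  -- If u ∉ S, it counts against v while at most w counts for v: 1 + 1 ≤ deg⁻ S v ≤ 1.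
  in-neighbour∈alliance : ∀ {S u v w} → GlobalOffensive1Alliance D S → v ∉ S →
                          (∀ x → adj D x v ≡ true → x ≡ u ⊎ x ≡ w) → adj D u v ≡ true → u ∈ S
  in-neighbour∈alliance {S} {u} {v} {w} (_ , offensive) v∉S among u→v with u ∈? S
  ... | yes u∈S = u∈S
  ... | no  u∉S = contradiction 2≤1 (<-irrefl refl)
    where
    S∩N⁻⊆⁅w⁆ : S ∩ N⁻ D v ⊆ ⁅ w ⁆
    S∩N⁻⊆⁅w⁆ {x} x∈ with x∈p∩q⁻ S (N⁻ D v) x∈
    ... | x∈S , x∈N⁻ = [ (λ x≡u → contradiction (subst (_∈ S) x≡u x∈S) u∉S)
                       , (λ x≡w → subst (_∈ ⁅ w ⁆) (sym x≡w) (x∈⁅x⁆ w)) ]′ (among x (∈tabulate⁻ x∈N⁻))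
    2≤1 : 2 ≤ 1
    2≤1 = ≤-trans (≤-trans (+-monoˡ-≤ 1 (x∈p⇒0<∣p∣ (x∈p∩q⁺ (x∉p⇒x∈∁p u∉S , ∈tabulate⁺ u→v))))
                           (offensive v v∉S))
                  (≤-trans (p⊆q⇒∣p∣≤∣q∣ S∩N⁻⊆⁅w⁆) (≤-reflexive (∣⁅x⁆∣≡1 w)))

  alliance-if-in-neighbours-inside : ∀ {S} → Dominating D S →
    (∀ v → v ∉ S → ∀ u → adj D u v ≡ true → u ∈ S) → GlobalOffensive1Alliance D S
  alliance-if-in-neighbours-inside {S} dominating inside-S = dominating , offensive
    where
    offensive : ∀ v → v ∉ S → deg⁻ D (∁ S) v + 1 ≤ deg⁻ D S v
    offensive v v∉S =
      let u , u∈S , u→v = dominating v v∉S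
          none-outside : Empty (∁ S ∩ N⁻ D v)
          none-outside (x , x∈) = let x∈∁S , x∈N⁻ = x∈p∩q⁻ (∁ S) (N⁻ D v) x∈ in
                                  x∈∁p⇒x∉p x∈∁S (inside-S v v∉S x (∈tabulate⁻ x∈N⁻))
      in +-mono-≤ (≤-reflexive (Empty⇒∣p∣≡0 none-outside)) (x∈p⇒0<∣p∣ (x∈p∩q⁺ (u∈S , ∈tabulate⁺ u→v)))

  infixr 5 _◅◅_
  _◅◅_ : ∀ {u v w} → UWalk D u v → UWalk D v w → UWalk D u w
  here      ◅◅ q = q
  there e p ◅◅ q = there e (p ◅◅ q)

  reverseWalk : ∀ {u v} → UWalk D u v → UWalk D v u
  reverseWalk here        = here
  reverseWalk (there e p) = reverseWalk p ◅◅ there (swap e) here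

  connected-via : ∀ r → (∀ u → UWalk D u r) → Connected D
  connected-via r reach u v = reach u ◅◅ reverseWalk (reach v)

module FunctionDigraph {n : ℕ} (active : Fin n → Bool) (f : Fin n → Fin n)
                       (f-irreflexive : ∀ v → f v ≢ v) where

  functionDigraph : Digraph n
  functionDigraph = record { adj = λ u v → active u ∧ does (f u ≟ v) ; loopless = loopless′ }
    where
    loopless′ : ∀ v → active v ∧ does (f v ≟ v) ≡ false
    loopless′ v with f v ≟ v
    ... | yes fv≡v = contradiction fv≡v (f-irreflexive v)
    ... | no  _    = ∧-zeroʳ (active v)

  functionDigraph-arc⁻ : ∀ {u v} → adj functionDigraph u v ≡ true → active u ≡ true × f u ≡ v
  functionDigraph-arc⁻ {u} {v} = decide (active u) (f u ≟ v)
    where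
    decide : ∀ a (fu≟v : Dec (f u ≡ v)) → a ∧ does fu≟v ≡ true → a ≡ true × f u ≡ v
    decide true  (yes fu≡v) _ = refl , fu≡v
    decide true  (no _)     ()
    decide false _          ()

  functionDigraph-arc⁺ : ∀ {u v} → active u ≡ true → f u ≡ v → adj functionDigraph u v ≡ true
  functionDigraph-arc⁺ {u} {v} au fu≡v =
    subst (λ a → a ∧ does (f u ≟ v) ≡ true) (sym au) (dec-true (f u ≟ v) fu≡v)

  functionDigraph-outdeg≡1 : ∀ v → active v ≡ true → outdeg functionDigraph v ≡ 1
  functionDigraph-outdeg≡1 _ av =
    outdeg≡1 functionDigraph (functionDigraph-arc⁺ av refl)
      (λ x v→x → sym (proj₂ (functionDigraph-arc⁻ v→x)))

  functionDigraph-outdeg≡0 : ∀ v → active v ≡ false → outdeg functionDigraph v ≡ 0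
  functionDigraph-outdeg≡0 _ av = outdeg≡0 functionDigraph λ x v→x →
    contradiction (trans (sym av) (proj₁ (functionDigraph-arc⁻ v→x))) λ ()

open FunctionDigraph using (functionDigraph)

Role : Set
Role = Fin 4

pattern near = zero
pattern far  = suc zero
pattern mid  = suc (suc zero)
pattern apex = suc (suc (suc zero))

data Vertex (b : ℕ) : Set where
  hub leaf : Vertex b
  node     : Fin b → Role → Vertex b

next : ∀ {b} → Vertex b → Vertex b
next hub           = leaf
next leaf          = hub
next (node i near) = node i apex
next (node i far)  = node i mid
next (node i mid)  = node i apex
next (node i apex) = hub

next-irreflexive : ∀ {b} (x : Vertex b) → next x ≢ x
next-irreflexive hub           ()
next-irreflexive leaf          ()
next-irreflexive (node i near) ()
next-irreflexive (node i far)  ()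
next-irreflexive (node i mid)  ()
next-irreflexive (node i apex) ()

next≡leaf : ∀ {b} (x : Vertex b) → next x ≡ leaf → x ≡ hub
next≡leaf hub           _  = refl
next≡leaf (node i near) ()
next≡leaf (node i far)  ()
next≡leaf (node i mid)  ()
next≡leaf (node i apex) ()

next≡node : ∀ {b i r} (x : Vertex b) → next x ≡ node i r → r ≡ mid ⊎ r ≡ apex
next≡node (node i near) refl = inj₂ refl
next≡node (node i far)  refl = inj₁ refl
next≡node (node i mid)  refl = inj₂ refl
next≡node (node i apex) ()

next≡apex : ∀ {b i} (x : Vertex b) → next x ≡ node i apex → x ≡ node i mid ⊎ x ≡ node i near
next≡apex (node i near) refl = inj₂ refl
next≡apex (node i mid)  refl = inj₁ refl
next≡apex (node i far)  ()
next≡apex (node i apex) ()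

active : ∀ {b} → Bool → Vertex b → Bool
active back leaf = back
active _    _    = true

2≤∣gadget∣ : ∀ {B : Subset 4} → near ∈ B → far ∈ B → 2 ≤ ∣ B ∣
2≤∣gadget∣ here (there here) = s≤s (s≤s z≤n)

3≤∣gadget∣ : ∀ {B : Subset 4} → near ∈ B → far ∈ B → mid ∈ B ⊎ apex ∈ B → 3 ≤ ∣ B ∣
3≤∣gadget∣ here (there here) (inj₁ (there (there here)))         = s≤s (s≤s (s≤s z≤n))
3≤∣gadget∣ {B = _ ∷ _ ∷ x ∷ _ ∷ []} here (there here) (inj₂ (there (there (there here)))) =
  s≤s (s≤s (∣p∣≤∣x∷p∣ x (inside ∷ [])))

sourceRoles : Subset 4
sourceRoles = inside ∷ inside ∷ outside ∷ outside ∷ []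

nonApexRoles : Subset 4
nonApexRoles = inside ∷ inside ∷ inside ∷ outside ∷ []

module _ (b : ℕ) where

  ⌜_⌝ : Vertex b → Fin (2 + b * 4)
  ⌜ hub ⌝      = zero
  ⌜ leaf ⌝     = suc zero
  ⌜ node i r ⌝ = suc (suc (combine i r))

  decode : Fin (2 + b * 4) → Vertex b
  decode zero          = hub
  decode (suc zero)    = leaf
  decode (suc (suc k)) = uncurry node (remQuot 4 k)

  decode-⌜⌝ : ∀ x → decode ⌜ x ⌝ ≡ x
  decode-⌜⌝ hub        = refl
  decode-⌜⌝ leaf       = refl
  decode-⌜⌝ (node i r) = cong (uncurry node) (remQuot-combine i r)

  ⌜⌝-decode : ∀ u → ⌜ decode u ⌝ ≡ u
  ⌜⌝-decode zero          = refl
  ⌜⌝-decode (suc zero)    = refl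
  ⌜⌝-decode (suc (suc k)) = cong (λ k → suc (suc k)) (combine-remQuot {b} 4 k)

  decode≡⇒≡⌜⌝ : ∀ {u x} → decode u ≡ x → u ≡ ⌜ x ⌝
  decode≡⇒≡⌜⌝ {u} eq = trans (sym (⌜⌝-decode u)) (cong ⌜_⌝ eq)

  everyVertex : {P : Fin (2 + b * 4) → Set} → (∀ x → P ⌜ x ⌝) → ∀ u → P u
  everyVertex {P} h u = subst P (⌜⌝-decode u) (h (decode u))

  step : Fin (2 + b * 4) → Fin (2 + b * 4)
  step = ⌜_⌝ ∘ next ∘ decode

  step-irreflexive : ∀ u → step u ≢ u
  step-irreflexive u eq = next-irreflexive (decode u) (trans (sym (decode-⌜⌝ _)) (cong decode eq))

  G : Bool → Digraph (2 + b * 4)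
  G back = functionDigraph (active back ∘ decode) step step-irreflexive

  module Arcs (back : Bool) = FunctionDigraph (active back ∘ decode) step step-irreflexive

  hubAnd : Subset 4 → Subset (2 + b * 4)
  hubAnd q = inside ∷ outside ∷ concat (replicate b q)

  ∣hubAnd∣ : ∀ q → ∣ hubAnd q ∣ ≡ suc (b * ∣ q ∣)
  ∣hubAnd∣ q = cong suc (∣concat-replicate∣ b q)

  node∈hubAnd : ∀ {q i r} → r ∈ q → ⌜ node i r ⌝ ∈ hubAnd q
  node∈hubAnd {q} {i} {r} r∈q = there (there (lookup⇒[]= (combine i r) (concat (replicate b q))
    (trans (lookup-concat (replicate b q) i r)
           (trans (cong (λ p → lookup p r) (lookup-replicate i q)) ([]=⇒lookup r∈q)))))

  gadget : Fin b → Subset (2 + b * 4) → Subset 4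
  gadget i (_ ∷ _ ∷ p) = block i p

  ∈gadget : ∀ {S} i {r} → ⌜ node i r ⌝ ∈ S → r ∈ gadget i S
  ∈gadget {_ ∷ _ ∷ p} i (there (there x∈p)) = ∈tabulate⁺ {f = lookup p ∘ combine i} ([]=⇒lookup x∈p)

  1+b*k≤∣S∣ : ∀ {k} S → ⌜ hub ⌝ ∈ S ⊎ ⌜ leaf ⌝ ∈ S → (∀ i → k ≤ ∣ gadget i S ∣) → suc (b * k) ≤ ∣ S ∣
  1+b*k≤∣S∣ (_ ∷ _ ∷ p) hub⊎leaf gadgets =
    ≤-trans (s≤s (*≤∣p∣-by-blocks b p gadgets)) (1+∣p∣≤∣x∷y∷p∣ p hub⊎leaf)

  module _ (back : Bool) where

    open Arcs back

    arc-next : ∀ x → active back x ≡ true → adj (G back) ⌜ x ⌝ ⌜ next x ⌝ ≡ true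
    arc-next x ax = functionDigraph-arc⁺
      (trans (cong (active back) (decode-⌜⌝ x)) ax) (cong (⌜_⌝ ∘ next) (decode-⌜⌝ x))

    arc⇒next≡ : ∀ {u y} → adj (G back) u ⌜ y ⌝ ≡ true → next (decode u) ≡ y
    arc⇒next≡ {y = y} u→y =
      trans (sym (decode-⌜⌝ _)) (trans (cong decode (proj₂ (functionDigraph-arc⁻ u→y))) (decode-⌜⌝ y))

    in-neighbour-leaf : ∀ u → adj (G back) u ⌜ leaf ⌝ ≡ true → u ≡ ⌜ hub ⌝
    in-neighbour-leaf u u→leaf = decode≡⇒≡⌜⌝ (next≡leaf (decode u) (arc⇒next≡ u→leaf))

    in-neighbour-apex : ∀ {i} u → adj (G back) u ⌜ node i apex ⌝ ≡ true →
                        u ≡ ⌜ node i mid ⌝ ⊎ u ≡ ⌜ node i near ⌝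
    in-neighbour-apex u u→apex = Sum.map decode≡⇒≡⌜⌝ decode≡⇒≡⌜⌝ (next≡apex (decode u) (arc⇒next≡ u→apex))

    hub⊎leaf∈dominating : ∀ {S} → Dominating (G back) S → ⌜ hub ⌝ ∈ S ⊎ ⌜ leaf ⌝ ∈ S
    hub⊎leaf∈dominating {S} dominating with ⌜ leaf ⌝ ∈? S
    ... | yes leaf∈S = inj₂ leaf∈S
    ... | no  leaf∉S = inj₁ (sole-in-neighbour∈dominating (G back) dominating leaf∉S in-neighbour-leaf)

    sources∈dominating : ∀ {S} → Dominating (G back) S → ∀ i → near ∈ gadget i S × far ∈ gadget i S
    sources∈dominating dominating i =
        ∈gadget i (source∈dominating (G back) dominating λ u u→near →
                   [ (λ ()) , (λ ()) ]′ (next≡node (decode u) (arc⇒next≡ u→near)))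
      , ∈gadget i (source∈dominating (G back) dominating λ u u→far →
                   [ (λ ()) , (λ ()) ]′ (next≡node (decode u) (arc⇒next≡ u→far)))

    mid⊎apex∈alliance : ∀ {S} → GlobalOffensive1Alliance (G back) S →
                        ∀ i → mid ∈ gadget i S ⊎ apex ∈ gadget i S
    mid⊎apex∈alliance {S} alliance i with ⌜ node i apex ⌝ ∈? S
    ... | yes apex∈S = inj₂ (∈gadget i apex∈S)
    ... | no  apex∉S = inj₁ (∈gadget i (in-neighbour∈alliance (G back) alliance apex∉S
                                        in-neighbour-apex (arc-next (node i mid) refl)))

    dominating-hubAnd : ∀ {q} → near ∈ q → far ∈ q → Dominating (G back) (hubAnd q)
    dominating-hubAnd near∈q far∈q = everyVertex λ where
      hub           hub∉  → contradiction here hub∉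
      leaf          _     → ⌜ hub ⌝ , here , arc-next hub refl
      (node i near) near∉ → contradiction (node∈hubAnd near∈q) near∉
      (node i far)  far∉  → contradiction (node∈hubAnd far∈q) far∉
      (node i mid)  _     → ⌜ node i far ⌝ , node∈hubAnd far∈q , arc-next (node i far) refl
      (node i apex) _     → ⌜ node i near ⌝ , node∈hubAnd near∈q , arc-next (node i near) refl

    γ : IsDominationNumber (G back) (suc (b * 2))
    γ = (hubAnd sourceRoles , dominating-hubAnd here (there here) , ∣hubAnd∣ sourceRoles)
      , λ S dominating → 1+b*k≤∣S∣ S (hub⊎leaf∈dominating dominating)
                           (λ i → uncurry 2≤∣gadget∣ (sources∈dominating dominating i))

    alliance-hubAnd-nonApex : GlobalOffensive1Alliance (G back) (hubAnd nonApexRoles)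
    alliance-hubAnd-nonApex = alliance-if-in-neighbours-inside (G back) (dominating-hubAnd here (there here))
      (everyVertex λ where
        hub           hub∉  → contradiction here hub∉
        leaf          _     u u→leaf → subst (_∈ hubAnd nonApexRoles) (sym (in-neighbour-leaf u u→leaf)) here
        (node i near) near∉ → contradiction (node∈hubAnd here) near∉
        (node i far)  far∉  → contradiction (node∈hubAnd (there here)) far∉
        (node i mid)  mid∉  → contradiction (node∈hubAnd (there (there here))) mid∉
        (node i apex) _     u u→apex →
          [ (λ u≡mid → subst (_∈ hubAnd nonApexRoles) (sym u≡mid) (node∈hubAnd (there (there here))))
          , (λ u≡near → subst (_∈ hubAnd nonApexRoles) (sym u≡near) (node∈hubAnd here)) ]′
          (in-neighbour-apex u u→apex))

    γ₁ᵒ : IsOffAllianceNumber (G back) (suc (b * 3))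
    γ₁ᵒ = (hubAnd nonApexRoles , alliance-hubAnd-nonApex , ∣hubAnd∣ nonApexRoles)
        , λ S alliance → 1+b*k≤∣S∣ S (hub⊎leaf∈dominating (proj₁ alliance)) λ i →
            let near∈ , far∈ = sources∈dominating (proj₁ alliance) i in
            3≤∣gadget∣ near∈ far∈ (mid⊎apex∈alliance alliance i)

    connected : Connected (G back)
    connected = connected-via (G back) ⌜ hub ⌝ (everyVertex toHub)
      where
      forward : ∀ x {v} → active back x ≡ true → UWalk (G back) ⌜ next x ⌝ v → UWalk (G back) ⌜ x ⌝ v
      forward x ax = there (inj₁ (arc-next x ax))

      toHub : ∀ x → UWalk (G back) ⌜ x ⌝ ⌜ hub ⌝
      toHub hub           = here
      toHub leaf          = there (inj₂ (arc-next hub refl)) here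
      toHub (node i near) = forward (node i near) refl (forward (node i apex) refl here)
      toHub (node i far)  = forward (node i far) refl
                              (forward (node i mid) refl (forward (node i apex) refl here))
      toHub (node i mid)  = forward (node i mid) refl (forward (node i apex) refl here)
      toHub (node i apex) = forward (node i apex) refl here

  functional : Functional (G true)
  functional zero          = Arcs.functionDigraph-outdeg≡1 true zero refl
  functional (suc zero)    = Arcs.functionDigraph-outdeg≡1 true (suc zero) refl
  functional (suc (suc k)) = Arcs.functionDigraph-outdeg≡1 true (suc (suc k)) refl

  directedTree : DirectedTree (G false)
  directedTree = s≤s z≤n , connected false , arcCount≡
    where
    open Arcs false
    open ≡-Reasoning
    arcCount≡ : arcCount (G false) ≡ suc (b * 4)
    arcCount≡ = begin
      sum (List.map (outdeg (G false)) (List.allFin _))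
        ≡⟨ cong sum (map-tabulate id (outdeg (G false))) ⟩
      sum (List.tabulate (outdeg (G false)))
        ≡⟨ cong₂ _+_ (functionDigraph-outdeg≡1 zero refl)
             (cong₂ _+_ (functionDigraph-outdeg≡0 (suc zero) refl)
               (sum-tabulate-const λ k → functionDigraph-outdeg≡1 (suc (suc k)) refl)) ⟩
      1 + (0 + b * 4 * 1)
        ≡⟨ cong suc (*-identityʳ (b * 4)) ⟩
      suc (b * 4)
        ∎

mainTheorem10 : (b : ℕ) → 1 ≤ b →
    (∃ λ n → Σ (Digraph n) λ D → Functional D × Connected D ×
       ∃ λ g → ∃ λ a → IsDominationNumber D g × IsOffAllianceNumber D a × a ≡ g + b)
    × (∃ λ n → Σ (Digraph n) λ T → DirectedTree T ×
       ∃ λ g → ∃ λ a → IsDominationNumber T g × IsOffAllianceNumber T a × a ≡ g + b)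
mainTheorem10 b _ =
    (_ , G b true  , functional b   , connected b true , _ , _ , γ b true  , γ₁ᵒ b true  , gap)
  , (_ , G b false , directedTree b ,                    _ , _ , γ b false , γ₁ᵒ b false , gap)
  where
  gap : suc (b * 3) ≡ suc (b * 2) + b
  gap = cong suc (trans (*-suc b 2) (+-comm b (b * 2)))
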